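{- Let $S,T$ be nonempty subsets of $[n-1]$, let $d=\gcd(S\cup T)$, and let $s^\ast\in[n-1]$. If the digraph of $T_n\langle S\cup\{s^\ast\};T\rangle$ contains a directed walk from $u$ to $v$ that uses exactly $\ell$ $s^\ast$-arcs, then there is a directed walk of length $\ell$ from $u'$ to $v'$ in $D(T_n\langle s^\ast;\emptyset\rangle)/\mathbb{Z}_d$ for some $u',v'\in\{1,\ldots,d\}$ with $u'\equiv u\pmod d$ and $v'\equiv v\pmod d$.
   Context: For $S,T\subseteq[n-1]$, $T_n\langle S;T\rangle$ denotes the $n\times n$ $(0,1)$-matrix whose $(i,j)$-entry is $1$ if and only if $j-i\in S$ or $i-j\in T$ (so $T_n\langle s^\ast;\emptyset\rangle$ has $(i,j)$-entry $1$ iff $j-i=s^\ast$). $D(C)$, the digraph of $C$, has vertex set $[n]$ and arc $(i,j)$ iff the $(i,j)$-entry of $C$ is $1$. An $s^\ast$-arc is an arc $(x,y)$ with $y-x=s^\ast$. $\gcd(S\cup T)$ is the gcd of all elements of $S\cup T$. For a digraph $D$ on $[n]$ and a positive integer $d$, $D/\mathbb{Z}_d$ is the digraph on $\{1,\ldots,d\}$ with an arc $(i,j)$ (loops allowed) if and only if $D$ has an arc $(m,l)$ with $m\equiv i$ and $l\equiv j\pmod d$; a walk of length $0$ from a vertex to itself is allowed. -}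

module Defs where

open import Data.Nat using (ℕ; zero; suc; _+_; _*_; _≤_; _<_)
open import Data.Nat.GCD using (gcd)
open import Data.List using (List; foldr; _++_)
open import Data.List.Membership.Propositional using (_∈_)
open import Data.Product using (Σ; _×_; ∃; ∃-syntax)
open import Data.Sum using (_⊎_)
open import Relation.Binary.PropositionalEquality using (_≡_)
open import Relation.Nullary using (yes; no)
open import Data.Nat using (_≟_)

InRange : ℕ → ℕ → Set
InRange m x = 1 ≤ x × x ≤ m

-- gcd of a finite set given as a list (gcd of the empty list is 0)
gcdList : List ℕ → ℕ
gcdList = foldr gcd 0

-- congruence modulo d (for d = 0 it is equality)
_≡_[mod_] : ℕ → ℕ → ℕ → Set
a ≡ b [mod d ] = (∃[ k ] a + k * d ≡ b) ⊎ (∃[ k ] b + k * d ≡ a)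

-- Arcs of D(T_n⟨S;T⟩) on vertex set [n]:
-- (x,y) is an arc iff y - x ∈ S or x - y ∈ T.
TArc : ℕ → List ℕ → List ℕ → ℕ → ℕ → Set
TArc n S T x y = InRange n x × InRange n y ×
  ((∃[ k ] k ∈ S × y ≡ x + k) ⊎ (∃[ k ] k ∈ T × x ≡ y + k))

TArcExt : ℕ → List ℕ → ℕ → List ℕ → ℕ → ℕ → Set
TArcExt n S s T x y = TArc n (s Data.List.∷ S) T x y

-- Arcs of D(C)/ℤ_d where C = T_n⟨s;∅⟩: on vertex set [d]
QArc : ℕ → ℕ → ℕ → ℕ → ℕ → Set
QArc n s d i j = InRange d i × InRange d j ×
  (∃[ m ] ∃[ l ] TArc n (s Data.List.∷ Data.List.[]) Data.List.[] m l
      × m ≡ i [mod d ] × l ≡ j [mod d ])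

data Walk (A : ℕ → ℕ → Set) : ℕ → ℕ → Set where
  []  : ∀ {u} → Walk A u u
  _∷_ : ∀ {u w v} → A u w → Walk A w v → Walk A u v

length : ∀ {A u v} → Walk A u v → ℕ
length []      = 0
length (_ ∷ p) = suc (length p)

countArcs : ∀ {A u v} → ℕ → Walk A u v → ℕ
countArcs s [] = 0
countArcs s (_∷_ {u} {w} _ p) with w ≟ u + s
... | yes _ = suc (countArcs s p)
... | no  _ = countArcs s p

{-# OPTIONS --safe #-}
-- Every arc of D(T_n⟨S ∪ {s*};T⟩) that is not an s*-arc moves by an element of S ∪ T, hence
-- by a multiple of d, and so stays in one residue class mod d; every s*-arc is itself an arc
-- of D(T_n⟨s*;∅⟩), so it projects to an arc of the quotient.  Replacing each vertex of the
-- walk by its representative in [d] and dropping the non-s* arcs therefore gives the walk.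
module Submission where

open import Defs
open import Data.Nat using (ℕ; _<_; suc; _+_; _*_; _∸_; _≤_; z≤n; s≤s; NonZero; _≟_; ≢-nonZero)
open import Data.Nat.Properties using (m<n⇒n≢0)
open import Data.Nat.DivMod using (_%_; _/_; m≡m%n+[m/n]*n; [m+kn]%n≡m%n; m%n<n)
open import Data.Nat.Divisibility using (_∣_; divides; ∣-trans)
open import Data.Nat.GCD using (gcd; gcd[m,n]∣m; gcd[m,n]∣n; gcd[m,n]≢0)
open import Data.List using (List; _∷_; []; _++_)
open import Data.List.Relation.Unary.All using (All; _∷_)
open import Data.List.Relation.Unary.Any using (here; there)
open import Data.List.Membership.Propositional using (_∈_)
open import Data.List.Membership.Propositional.Properties using (∈-++⁺ˡ; ∈-++⁺ʳ)
open import Data.Product using (Σ; _×_; ∃-syntax; _,_)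
open import Data.Sum using (inj₁; inj₂)
open import Relation.Nullary using (yes; no; contradiction)
open import Relation.Binary.PropositionalEquality using (_≡_; _≢_; refl; sym; cong)

∈⇒gcdList∣ : ∀ {k} (L : List ℕ) → k ∈ L → gcdList L ∣ k
∈⇒gcdList∣ (x ∷ L) (here refl) = gcd[m,n]∣m x (gcdList L)
∈⇒gcdList∣ (x ∷ L) (there k∈L) = ∣-trans (gcd[m,n]∣n x (gcdList L)) (∈⇒gcdList∣ L k∈L)

module Representative (d : ℕ) .{{_ : NonZero d}} where

  -- The representative of x in [d] = {1,…,d}; it is congruent to x only when 1 ≤ x.
  repr : ℕ → ℕ
  repr x = suc ((x ∸ 1) % d)

  repr-inRange : ∀ x → InRange d (repr x)
  repr-inRange x = s≤s z≤n , m%n<n (x ∸ 1) d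

  repr+quotient : ∀ x → 1 ≤ x → repr x + ((x ∸ 1) / d) * d ≡ x
  repr+quotient (suc x) _ = cong suc (sym (m≡m%n+[m/n]*n x d))

  repr≡[mod] : ∀ x → 1 ≤ x → repr x ≡ x [mod d ]
  repr≡[mod] x 1≤x = inj₁ ((x ∸ 1) / d , repr+quotient x 1≤x)

  ≡repr[mod] : ∀ x → 1 ≤ x → x ≡ repr x [mod d ]
  ≡repr[mod] x 1≤x = inj₂ ((x ∸ 1) / d , repr+quotient x 1≤x)

  repr-+-∣ : ∀ x k → 1 ≤ x → d ∣ k → repr (x + k) ≡ repr x
  repr-+-∣ (suc x) k _ (divides c refl) = cong suc ([m+kn]%n≡m%n x c d)

module WalkProjection
  (d : ℕ) .{{_ : NonZero d}} (n : ℕ) (S T : List ℕ) (s : ℕ)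
  (d∣S : ∀ {k} → k ∈ S → d ∣ k) (d∣T : ∀ {k} → k ∈ T → d ∣ k)
  where

  open Representative d

  Arc : ℕ → ℕ → Set
  Arc = TArcExt n S s T

  repr-arc≡ : ∀ {u w} → Arc u w → w ≢ u + s → repr w ≡ repr u
  repr-arc≡ (_ , _ , inj₁ (k , here refl , w≡u+s)) w≢u+s = contradiction w≡u+s w≢u+s
  repr-arc≡ ((1≤u , _) , _ , inj₁ (k , there k∈S , refl)) _ = repr-+-∣ _ k 1≤u (d∣S k∈S)
  repr-arc≡ (_ , (1≤w , _) , inj₂ (k , k∈T , refl)) _ = sym (repr-+-∣ _ k 1≤w (d∣T k∈T))

  sArc⇒QArc : ∀ {u w} → Arc u w → w ≡ u + s → QArc n s d (repr u) (repr w)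
  sArc⇒QArc {u} {w} (u∈[n]@(1≤u , _) , w∈[n]@(1≤w , _) , _) w≡u+s =
    repr-inRange u , repr-inRange w , u , w ,
    (u∈[n] , w∈[n] , inj₁ (s , here refl , w≡u+s)) ,
    ≡repr[mod] u 1≤u , ≡repr[mod] w 1≤w

  project : ∀ {u v} (p : Walk Arc u v) →
    Σ (Walk (QArc n s d) (repr u) (repr v)) (λ q → length q ≡ countArcs s p)
  project [] = [] , refl
  project (_∷_ {u} {w} a p) with w ≟ u + s | project p
  ... | yes w≡u+s | q , |q|≡count = sArc⇒QArc a w≡u+s ∷ q , cong suc |q|≡count
  ... | no w≢u+s  | projection rewrite sym (repr-arc≡ a w≢u+s) = projection

lemma3p7 : (n : ℕ) (S T : List ℕ) (s : ℕ) →
    S ≢ [] → T ≢ [] →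
    All (λ x → InRange n x × x < n) S → All (λ x → InRange n x × x < n) T →
    InRange n s → s < n →
    (u v ℓ : ℕ) → InRange n u → InRange n v →
    (p : Walk (TArcExt n S s T) u v) → countArcs s p ≡ ℓ →
    ∃[ u' ] ∃[ v' ] InRange (gcdList (S ++ T)) u' × InRange (gcdList (S ++ T)) v'
      × u' ≡ u [mod gcdList (S ++ T) ] × v' ≡ v [mod gcdList (S ++ T) ]
      × Σ (Walk (QArc n s (gcdList (S ++ T))) u' v') (λ q → length q ≡ ℓ)
lemma3p7 n [] T s S≢[] _ _ _ _ _ _ _ _ _ _ _ _ = contradiction refl S≢[]
lemma3p7 n S@(x ∷ _) T s _ _ (((1≤x , _) , _) ∷ _) _ _ _ u v ℓ (1≤u , _) (1≤v , _) p refl =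
  repr u , repr v , repr-inRange u , repr-inRange v , repr≡[mod] u 1≤u , repr≡[mod] v 1≤v ,
  project p
  where
  d = gcdList (S ++ T)
  instance
    d≢0 : NonZero d
    d≢0 = ≢-nonZero (gcd[m,n]≢0 x _ (inj₁ (m<n⇒n≢0 1≤x)))
  open Representative d
  open WalkProjection d n S T s (λ k∈S → ∈⇒gcdList∣ (S ++ T) (∈-++⁺ˡ k∈S))
                                (λ k∈T → ∈⇒gcdList∣ (S ++ T) (∈-++⁺ʳ S k∈T))
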